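{- Every PA set $A$ is weakly Kurtz engulfing.
   Context: $A$ is PA if it computes a $\{0,1\}$-valued diagonally nonrecursive function, i.e. a $g:\omega\to\{0,1\}$ with $g\le_T A$ such that $g(e)\ne\varphi_e(e)$ whenever $\varphi_e(e)$ converges ($\varphi_e$ the $e$-th partial computable function). A Kurtz test relative to $A$ is an $A$-computable sequence $(G_m)$ of clopen subsets of $2^\omega$ with $\lambda(G_m)\le 2^{ -m}$ ($\lambda$ the uniform measure). $A$ is weakly Kurtz engulfing if there is an $A$-computable sequence $((G^i_m)_m)_i$ of Kurtz tests relative to $A$ such that $\bigcup_i\bigcap_m G^i_m$ contains every computable element of $2^\omega$. -}

module Defs where

open import Data.Nat using (ℕ; zero; suc; _+_; _*_; _^_; _≤_; _⊔_)
open import Data.Nat.DivMod using (_mod_)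
open import Data.Fin using (Fin)
open import Data.Vec using (Vec; []; _∷_; lookup)
open import Data.List using (List; []; _∷_; length; map; upTo)
open import Data.List.Relation.Unary.Any using (Any)
open import Data.Bool using (Bool; true; false; if_then_else_; _∧_; _∨_)
open import Data.Maybe using (Maybe; just; nothing; _>>=_)
open import Data.Product using (Σ; ∃; _×_; _,_)
open import Relation.Binary.PropositionalEquality using (_≡_; _≢_)

Oracle : Set
Oracle = ℕ → Bool

b2n : Bool → ℕ
b2n true  = 1
b2n false = 0

-- the empty oracle (used for unrelativized computability)
∅ : Oracle
∅ _ = false

-- Oracle μ-recursive programs of arity n.
--   zer      : constant 0
--   sucP     : successor
--   proj i   : i-th projection
--   orc      : characteristic function of the oracle
--   comp f gs: f (g₁ xs, …, gₘ xs)
--   prec f g : h 0 xs = f xs ; h (y+1) xs = g (y , h y xs , xs)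
--   mu f     : least y with f (y , xs) = 0 (and f (z , xs) ↓ ≠ 0 for z < y)

data Prog : ℕ → Set where
  zer  : ∀ {n} → Prog n
  sucP : Prog 1
  proj : ∀ {n} → Fin n → Prog n
  orc  : Prog 1
  comp : ∀ {m n} → Prog m → Vec (Prog n) m → Prog n
  prec : ∀ {n} → Prog n → Prog (suc (suc n)) → Prog (suc n)
  mu   : ∀ {n} → Prog (suc n) → Prog n

-- Step-indexed (fuel-bounded) evaluation.  'just v' means the
-- computation halts with output v within the given fuel.
mutual
  eval : ∀ {n} → Oracle → ℕ → Prog n → Vec ℕ n → Maybe ℕ
  eval A zero    _           _            = nothing
  eval A (suc s) zer         xs           = just 0
  eval A (suc s) sucP        (x ∷ [])     = just (suc x)
  eval A (suc s) (proj i)    xs           = just (lookup xs i)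
  eval A (suc s) orc         (x ∷ [])     = just (b2n (A x))
  eval A (suc s) (comp f gs) xs           = evalVec A s gs xs >>= λ ys → eval A s f ys
  eval A (suc s) (prec f g)  (y ∷ xs)     = evalRec A s f g y xs
  eval A (suc s) (mu f)      xs           = search A s f xs 0 s

  evalVec : ∀ {m n} → Oracle → ℕ → Vec (Prog n) m → Vec ℕ n → Maybe (Vec ℕ m)
  evalVec A s []       xs = just []
  evalVec A s (g ∷ gs) xs =
    eval A s g xs >>= λ v → evalVec A s gs xs >>= λ vs → just (v ∷ vs)

  evalRec : ∀ {n} → Oracle → ℕ → Prog n → Prog (suc (suc n)) → ℕ → Vec ℕ n → Maybe ℕ
  evalRec A s f g zero    xs = eval A s f xs
  evalRec A s f g (suc y) xs = evalRec A s f g y xs >>= λ r → eval A s g (y ∷ r ∷ xs)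

  search : ∀ {n} → Oracle → ℕ → Prog (suc n) → Vec ℕ n → ℕ → ℕ → Maybe ℕ
  search A s f xs y zero    = nothing
  search A s f xs y (suc k) with eval A s f (y ∷ xs)
  ... | nothing      = nothing
  ... | just zero    = just y
  ... | just (suc _) = search A s f xs (suc y) k

_⊢_·_↓_ : ∀ {n} → Oracle → Prog n → Vec ℕ n → ℕ → Set
A ⊢ p · xs ↓ v = ∃ λ s → eval A s p xs ≡ just v

_≤T_ : (ℕ → ℕ) → Oracle → Set
f ≤T A = Σ (Prog 1) λ p → ∀ x → A ⊢ p · (x ∷ []) ↓ f x

unpair : ℕ → ℕ × ℕ
unpair zero = 0 , 0
unpair (suc c) with unpair c
... | zero  , b = suc b , 0
... | suc a , b = a , suc b

mutual
  -- decode fuel arity code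
  decode : ℕ → (n : ℕ) → ℕ → Prog n
  decode zero    n c = zer
  decode (suc f) n c = dec f n (unpair c)

  dec : ℕ → (n : ℕ) → ℕ × ℕ → Prog n
  dec f (suc zero) (1 , r) = sucP
  dec f (suc zero) (2 , r) = orc
  dec f (suc n)    (3 , r) = proj (r mod (suc n))
  dec f n          (4 , r) with unpair r
  ... | m , r′ with unpair r′
  ...   | cf , cgs = comp (decode f m cf) (decodeVec f m n cgs)
  dec f (suc n)    (5 , r) with unpair r
  ... | a , b = prec (decode f n a) (decode f (suc (suc n)) b)
  dec f n          (6 , r) = mu (decode f (suc n) r)
  dec f n          _       = zer

  decodeVec : ℕ → (m n : ℕ) → ℕ → Vec (Prog n) m
  decodeVec f zero    n c = []
  decodeVec f (suc m) n c with unpair c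
  ... | a , b = decode f n a ∷ decodeVec f m n b

φprog : ℕ → Prog 1
φprog e = decode e 1 e

φ_⟨_⟩↓_ : ℕ → ℕ → ℕ → Set
φ e ⟨ x ⟩↓ v = ∅ ⊢ φprog e · (x ∷ []) ↓ v

-- A computes a {0,1}-valued DNC function
IsPA : Oracle → Set
IsPA A = Σ (ℕ → Bool) λ g →
  ((λ e → b2n (g e)) ≤T A) × (∀ e v → φ e ⟨ e ⟩↓ v → b2n (g e) ≢ v)

Computable : (ℕ → Bool) → Set
Computable X = (λ n → b2n (X n)) ≤T ∅

-- Clopen subsets of 2^ω: finite lists of binary strings (union of the
-- basic cylinders [σ]), coded by natural numbers.

Str : Set
Str = List Bool

Clopen : Set
Clopen = List Str

decodeList : {X : Set} → (ℕ → X) → ℕ → ℕ → List X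
decodeList d zero    c       = []
decodeList d (suc f) zero    = []
decodeList d (suc f) (suc c) with unpair c
... | a , b = d a ∷ decodeList d f b

decodeBit : ℕ → Bool
decodeBit zero    = false
decodeBit (suc _) = true

decodeStr : ℕ → Str
decodeStr c = decodeList decodeBit c c

decodeClopen : ℕ → Clopen
decodeClopen c = decodeList decodeStr c c

_∈C_ : (ℕ → Bool) → Clopen → Set
X ∈C G = Any (λ σ → σ ≡ map X (upTo (length σ))) G

-- measure: with L the maximal length of a string in G,
-- λ(G) = #{τ ∈ 2^L : some σ ∈ G is a prefix of τ} / 2^L
_==b_ : Bool → Bool → Bool
true  ==b true  = true
false ==b false = true
_     ==b _     = false

isPrefix : Str → Str → Bool
isPrefix []       _        = true
isPrefix (_ ∷ _)  []       = false
isPrefix (a ∷ as) (b ∷ bs) = (a ==b b) ∧ isPrefix as bs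

anyB : {X : Set} → (X → Bool) → List X → Bool
anyB p []       = false
anyB p (x ∷ xs) = p x ∨ anyB p xs

countB : {X : Set} → (X → Bool) → List X → ℕ
countB p []       = 0
countB p (x ∷ xs) = (if p x then 1 else 0) + countB p xs

strings : ℕ → List Str
strings zero    = [] ∷ []
strings (suc n) = Data.List._++_ (map (false ∷_) (strings n)) (map (true ∷_) (strings n))

maxLen : Clopen → ℕ
maxLen []       = 0
maxLen (σ ∷ G)  = length σ ⊔ maxLen G

coverCount : Clopen → ℕ
coverCount G = countB (λ τ → anyB (λ σ → isPrefix σ τ) G) (strings (maxLen G))

MeasureAtMost2^- : Clopen → ℕ → Set
MeasureAtMost2^- G m = coverCount G * 2 ^ m ≤ 2 ^ maxLen G

-- Weakly Kurtz engulfing: an A-computable double sequence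
-- G^i_m = decodeClopen (h i m) such that each (G^i_m)_m is a Kurtz test
-- relative to A, and ⋃_i ⋂_m G^i_m contains every computable X.

WeaklyKurtzEngulfing : Oracle → Set
WeaklyKurtzEngulfing A = Σ (ℕ → ℕ → ℕ) λ h →
  (Σ (Prog 2) λ p → ∀ i m → A ⊢ p · (i ∷ m ∷ []) ↓ h i m)
  × (∀ i m → MeasureAtMost2^- (decodeClopen (h i m)) m)
  × (∀ X → Computable X → ∃ λ i → ∀ m → X ∈C decodeClopen (h i m))

module Submission where

-- Let g ≤_T A be {0,1}-valued and DNC.  For a program code i and j ∈ ω let
-- e(i,j) be the code of the program "run program i on input j"; then
-- φ_e(e) = φ_i(j), so the DNC property says g(e(i,j)) ≠ φ_i(j) whenever
-- φ_i(j)↓.  Hence the A-computable sequence Y_i(j) = 1 - g(e(i,j)) equals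
-- X whenever program i computes the {0,1}-valued X.  We take G^i_m to be
-- the cylinder [Y_i ↾ m], of measure exactly 2^-m, so X ∈ ⋂_m G^i_m.

open import Defs
open import Data.Nat
open import Data.Nat.Properties
open import Data.Nat.DivMod using (_mod_; m<n⇒m%n≡m)
open import Data.Fin using (Fin; toℕ; #_)
open import Data.Fin.Properties using (toℕ-injective; toℕ-fromℕ<; toℕ<n)
open import Data.Vec using (Vec; []; _∷_; lookup)
open import Data.List using (List; []; _∷_; map; length; upTo; _++_)
open import Data.Product using (_,_; ∃; proj₁; proj₂)
open import Data.Maybe using (just)
open import Data.Bool using (Bool; true; false; not; if_then_else_)
open import Data.Bool.Properties using (∨-identityʳ)
open import Data.List.Properties using (length-map; length-upTo; map-upTo; map-applyUpTo; map-cong)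
open import Data.List.Relation.Unary.Any using (here)
open import Function using (_∘_)
open import Data.Empty using (⊥-elim)
open import Relation.Binary.PropositionalEquality

-- Cantor pairing: 'pair' is the inverse of the enumeration 'unpair'
-- from Defs, which walks the diagonals a + b = n with b increasing.

tri : ℕ → ℕ
tri zero    = zero
tri (suc d) = suc d + tri d

pair : ℕ → ℕ → ℕ
pair a b = tri (a + b) + b

pair-next-diagonal : ∀ d → pair (suc d) 0 ≡ suc (pair 0 d)
pair-next-diagonal d
  rewrite +-identityʳ d | +-identityʳ (d + tri d) = cong suc (+-comm d (tri d))

pair-along-diagonal : ∀ a b → pair a (suc b) ≡ suc (pair (suc a) b)
pair-along-diagonal a b rewrite +-suc a b = +-suc (tri (suc (a + b))) b

unpair-new-diagonal : ∀ c {b} → unpair c ≡ (0 , b) → unpair (suc c) ≡ (suc b , 0)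
unpair-new-diagonal c eq rewrite eq = refl

unpair-same-diagonal : ∀ c {a b} → unpair c ≡ (suc a , b) → unpair (suc c) ≡ (a , suc b)
unpair-same-diagonal c eq rewrite eq = refl

unpair-pair : ∀ a b → unpair (pair a b) ≡ (a , b)
unpair-pair a b = onDiagonal (a + b) a b refl
  where
  onDiagonal : ∀ n a b → a + b ≡ n → unpair (pair a b) ≡ (a , b)
  onDiagonal n       zero    zero    _  = refl
  onDiagonal (suc n) (suc d) zero    eq =
    trans (cong unpair (pair-next-diagonal d))
          (unpair-new-diagonal (pair 0 d) (onDiagonal n 0 d (suc-injective (trans (sym (+-identityʳ (suc d))) eq))))
  onDiagonal n       a       (suc b) eq =
    trans (cong unpair (pair-along-diagonal a b))
          (unpair-same-diagonal (pair (suc a) b) (onDiagonal n (suc a) b (trans (sym (+-suc a b)) eq)))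

pair-boundˡ : ∀ a b → a ≤ pair a b
pair-boundˡ a b = ≤-trans (m≤m+n a b) (≤-trans (n≤tri (a + b)) (m≤m+n _ b))
  where
  n≤tri : ∀ n → n ≤ tri n
  n≤tri zero    = z≤n
  n≤tri (suc n) = m≤m+n (suc n) (tri n)

pair-boundʳ : ∀ a b → b ≤ pair a b
pair-boundʳ a b = m≤n+m b (tri (a + b))

pair-tag-bound : ∀ t r → r < pair (suc t) r
pair-tag-bound t r = +-monoˡ-≤ r (s≤s z≤n)

-- Gödel numbering of programs, inverse to Defs.decode whenever the
-- decoding fuel is at least the code.

mutual
  enc : ∀ {n} → Prog n → ℕ
  enc zer             = 0
  enc sucP            = pair 1 0
  enc orc             = pair 2 0
  enc (proj i)        = pair 3 (toℕ i)
  enc (comp {m} f gs) = pair 4 (pair m (pair (enc f) (encVec gs)))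
  enc (prec f g)      = pair 5 (pair (enc f) (enc g))
  enc (mu f)          = pair 6 (enc f)

  encVec : ∀ {m n} → Vec (Prog n) m → ℕ
  encVec []       = 0
  encVec (g ∷ gs) = pair (enc g) (encVec gs)

-- One decoding step for each constructor.  ('dec' is defined by
-- overlapping clauses, so the arity has to be split to compute it.)

decode-zero : ∀ f n → decode f n 0 ≡ zer
decode-zero zero    n             = refl
decode-zero (suc f) zero          = refl
decode-zero (suc f) (suc zero)    = refl
decode-zero (suc f) (suc (suc n)) = refl

decode-pair : ∀ f n t r → decode (suc f) n (pair t r) ≡ dec f n (t , r)
decode-pair f n t r = cong (dec f n) (unpair-pair t r)

toℕ-mod : ∀ {n} (i : Fin (suc n)) → toℕ i mod suc n ≡ i
toℕ-mod i = toℕ-injective (trans (toℕ-fromℕ< _) (m<n⇒m%n≡m (toℕ<n i)))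

dec-proj : ∀ f {n} (i : Fin (suc n)) → dec f (suc n) (3 , toℕ i) ≡ proj i
dec-proj f {zero}  i = cong proj (toℕ-mod i)
dec-proj f {suc n} i = cong proj (toℕ-mod i)

dec-comp : ∀ f n m a b →
  dec f n (4 , pair m (pair a b)) ≡ comp (decode f m a) (decodeVec f m n b)
dec-comp f zero          m a b rewrite unpair-pair m (pair a b) | unpair-pair a b = refl
dec-comp f (suc zero)    m a b rewrite unpair-pair m (pair a b) | unpair-pair a b = refl
dec-comp f (suc (suc n)) m a b rewrite unpair-pair m (pair a b) | unpair-pair a b = refl

dec-prec : ∀ f n a b →
  dec f (suc n) (5 , pair a b) ≡ prec (decode f n a) (decode f (suc (suc n)) b)
dec-prec f zero    a b rewrite unpair-pair a b = refl
dec-prec f (suc n) a b rewrite unpair-pair a b = refl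

dec-mu : ∀ f n a → dec f n (6 , a) ≡ mu (decode f (suc n) a)
dec-mu f zero          a = refl
dec-mu f (suc zero)    a = refl
dec-mu f (suc (suc n)) a = refl

decodeVec-pair : ∀ f m n a b →
  decodeVec f (suc m) n (pair a b) ≡ decode f n a ∷ decodeVec f m n b
decodeVec-pair f m n a b rewrite unpair-pair a b = refl

≤-pairˡ : ∀ a b {f} → pair a b ≤ f → a ≤ f
≤-pairˡ a b = ≤-trans (pair-boundˡ a b)

≤-pairʳ : ∀ a b {f} → pair a b ≤ f → b ≤ f
≤-pairʳ a b = ≤-trans (pair-boundʳ a b)

≤-payload : ∀ t r {f} → pair (suc t) r ≤ suc f → r ≤ f
≤-payload t r le = s≤s⁻¹ (≤-trans (pair-tag-bound t r) le)

mutual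
  decode-enc : ∀ {n} f (p : Prog n) → enc p ≤ f → decode f n (enc p) ≡ p
  decode-enc f       zer      _  = decode-zero f _
  decode-enc (suc f) sucP     _  = refl
  decode-enc (suc f) orc      _  = refl
  decode-enc {suc n} (suc f) (proj i) _ = trans (decode-pair f _ 3 (toℕ i)) (dec-proj f i)
  decode-enc {n} (suc f) (comp {m} p gs) le =
    trans (decode-pair f n 4 _)
      (trans (dec-comp f n m (enc p) (encVec gs))
             (cong₂ comp (decode-enc f p (≤-pairˡ _ (encVec gs) args)) (decodeVec-encVec f gs (≤-pairʳ (enc p) _ args))))
    where args = ≤-pairʳ m _ (≤-payload 3 _ le)
  decode-enc {suc n} (suc f) (prec p q) le =
    trans (decode-pair f _ 5 _)
      (trans (dec-prec f n (enc p) (enc q))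
             (cong₂ prec (decode-enc f p (≤-pairˡ _ (enc q) args))
                         (decode-enc f q (≤-pairʳ (enc p) _ args))))
    where args = ≤-payload 4 _ le
  decode-enc {n} (suc f) (mu p) le =
    trans (decode-pair f _ 6 _) (trans (dec-mu f n (enc p)) (cong mu (decode-enc f p (≤-payload 5 _ le))))

  decodeVec-encVec : ∀ {m n} f (gs : Vec (Prog n) m) → encVec gs ≤ f → decodeVec f m n (encVec gs) ≡ gs
  decodeVec-encVec f []       _  = refl
  decodeVec-encVec {suc m} {n} f (g ∷ gs) le =
    trans (decodeVec-pair f m n (enc g) (encVec gs))
          (cong₂ _∷_ (decode-enc f g (≤-pairˡ _ (encVec gs) le)) (decodeVec-encVec f gs (≤-pairʳ (enc g) _ le)))

mutual
  eval-suc : ∀ {n} A s (p : Prog n) xs {v} → eval A s p xs ≡ just v → eval A (suc s) p xs ≡ just v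
  eval-suc A (suc s) zer         xs       eq = eq
  eval-suc A (suc s) sucP        (x ∷ []) eq = eq
  eval-suc A (suc s) (proj i)    xs       eq = eq
  eval-suc A (suc s) orc         (x ∷ []) eq = eq
  eval-suc A (suc s) (comp f gs) xs       eq with evalVec A s gs xs in args
  ... | just ys rewrite evalVec-suc A s gs xs args = eval-suc A s f ys eq
  eval-suc A (suc s) (prec f g)  (y ∷ xs) eq = evalRec-suc A s f g y xs eq
  eval-suc A (suc s) (mu f)      xs       eq = search-suc A s f xs 0 s eq

  evalVec-suc : ∀ {m n} A s (gs : Vec (Prog n) m) xs {ys} →
    evalVec A s gs xs ≡ just ys → evalVec A (suc s) gs xs ≡ just ys
  evalVec-suc A s []       xs eq = eq
  evalVec-suc A s (g ∷ gs) xs eq with eval A s g xs in head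
  ... | just v with evalVec A s gs xs in tail
  ...   | just vs rewrite eval-suc A s g xs head | evalVec-suc A s gs xs tail = eq

  evalRec-suc : ∀ {n} A s (f : Prog n) g y xs {v} →
    evalRec A s f g y xs ≡ just v → evalRec A (suc s) f g y xs ≡ just v
  evalRec-suc A s f g zero    xs eq = eval-suc A s f xs eq
  evalRec-suc A s f g (suc y) xs eq with evalRec A s f g y xs in previous
  ... | just r rewrite evalRec-suc A s f g y xs previous = eval-suc A s g (y ∷ r ∷ xs) eq

  search-suc : ∀ {n} A s (f : Prog (suc n)) xs y k {v} →
    search A s f xs y k ≡ just v → search A (suc s) f xs y (suc k) ≡ just v
  search-suc A s f xs y (suc k) eq with eval A s f (y ∷ xs) in test
  ... | just zero    rewrite eval-suc A s f (y ∷ xs) test = eq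
  ... | just (suc w) rewrite eval-suc A s f (y ∷ xs) test = search-suc A s f xs (suc y) k eq

fuel-mono : {P : ℕ → Set} → (∀ s → P s → P (suc s)) → ∀ {s t} → s ≤ t → P s → P t
fuel-mono {P} step le = go (≤⇒≤′ le)
  where
  go : ∀ {s t} → s ≤′ t → P s → P t
  go ≤′-refl        ps = ps
  go (≤′-step s≤′t) ps = step _ (go s≤′t ps)

eval-mono : ∀ {n A s t} {p : Prog n} {xs v} → s ≤ t → eval A s p xs ≡ just v → eval A t p xs ≡ just v
eval-mono {A = A} {p = p} {xs} = fuel-mono (λ s → eval-suc A s p xs)

evalVec-mono : ∀ {m n A s t} {gs : Vec (Prog n) m} {xs ys} →
  s ≤ t → evalVec A s gs xs ≡ just ys → evalVec A t gs xs ≡ just ys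
evalVec-mono {A = A} {gs = gs} {xs} = fuel-mono (λ s → evalVec-suc A s gs xs)

evalRec-mono : ∀ {n A s t} {f : Prog n} {g y xs v} →
  s ≤ t → evalRec A s f g y xs ≡ just v → evalRec A t f g y xs ≡ just v
evalRec-mono {A = A} {f = f} {g} {y} {xs} = fuel-mono (λ s → evalRec-suc A s f g y xs)

variable
  A    : Oracle
  m n  : ℕ
  xs   : Vec ℕ n

data _⊢_·ᵛ_↓_ (A : Oracle) : Vec (Prog n) m → Vec ℕ n → Vec ℕ m → Set where
  []↓ : A ⊢ [] ·ᵛ xs ↓ []
  ∷↓  : ∀ {g : Prog n} {gs : Vec (Prog n) m} {v vs} →
        A ⊢ g · xs ↓ v → A ⊢ gs ·ᵛ xs ↓ vs → A ⊢ (g ∷ gs) ·ᵛ xs ↓ (v ∷ vs)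

evalVec↓ : ∀ {gs : Vec (Prog n) m} {ys} → A ⊢ gs ·ᵛ xs ↓ ys → ∃ λ s → evalVec A s gs xs ≡ just ys
evalVec↓ []↓ = 0 , refl
evalVec↓ {A = A} {xs = xs} (∷↓ {g = g} {gs} {v} {vs} (s₁ , head) tail↓) with evalVec↓ tail↓
... | s₂ , tail = s₁ ⊔ s₂ , both
  where
  both : evalVec A (s₁ ⊔ s₂) (g ∷ gs) xs ≡ just (v ∷ vs)
  both rewrite eval-mono {p = g} (m≤m⊔n s₁ s₂) head | evalVec-mono {gs = gs} (m≤n⊔m s₁ s₂) tail = refl

zer↓ : A ⊢ zer · xs ↓ 0
zer↓ = 1 , refl

suc↓ : ∀ {x} → A ⊢ sucP · (x ∷ []) ↓ suc x
suc↓ = 1 , refl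

proj↓ : (i : Fin n) → A ⊢ proj i · xs ↓ lookup xs i
proj↓ i = 1 , refl

comp↓ : ∀ {f : Prog m} {gs : Vec (Prog n) m} {ys v} →
  A ⊢ gs ·ᵛ xs ↓ ys → A ⊢ f · ys ↓ v → A ⊢ comp f gs · xs ↓ v
comp↓ {A = A} {xs = xs} {f} {gs} {ys} {v} args↓ (s₂ , result) with evalVec↓ args↓
... | s₁ , args = suc (s₁ ⊔ s₂) , both
  where
  both : eval A (suc (s₁ ⊔ s₂)) (comp f gs) xs ≡ just v
  both rewrite evalVec-mono {gs = gs} (m≤m⊔n s₁ s₂) args = eval-mono (m≤n⊔m s₁ s₂) result

prec↓ : ∀ {f : Prog n} {g} (H : ℕ → ℕ) →
  A ⊢ f · xs ↓ H 0 → (∀ y → A ⊢ g · (y ∷ H y ∷ xs) ↓ H (suc y)) →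
  ∀ y → A ⊢ prec f g · (y ∷ xs) ↓ H y
prec↓ {A = A} {xs = xs} {f = f} {g = g} H base step y = suc (proj₁ (recursion y)) , proj₂ (recursion y)
  where
  recursion : ∀ y → ∃ λ s → evalRec A s f g y xs ≡ just (H y)
  recursion zero    = base
  recursion (suc y) with recursion y | step y
  ... | s₁ , previous | s₂ , next = s₁ ⊔ s₂ , both
    where
    both : evalRec A (s₁ ⊔ s₂) f g (suc y) xs ≡ just (H (suc y))
    both rewrite evalRec-mono {f = f} {g} {y} {xs} (m≤m⊔n s₁ s₂) previous = eval-mono (m≤n⊔m s₁ s₂) next

app₁ : Prog 1 → Prog n → Prog n
app₁ f a = comp f (a ∷ [])

app₂ : Prog 2 → Prog n → Prog n → Prog n
app₂ f a b = comp f (a ∷ b ∷ [])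

app₁↓ : ∀ {f a u v} → A ⊢ a · xs ↓ u → A ⊢ f · (u ∷ []) ↓ v → A ⊢ app₁ f a · xs ↓ v
app₁↓ a↓ f↓ = comp↓ (∷↓ a↓ []↓) f↓

app₂↓ : ∀ {f a b u w v} →
  A ⊢ a · xs ↓ u → A ⊢ b · xs ↓ w → A ⊢ f · (u ∷ w ∷ []) ↓ v → A ⊢ app₂ f a b · xs ↓ v
app₂↓ a↓ b↓ f↓ = comp↓ (∷↓ a↓ (∷↓ b↓ []↓)) f↓

const : ℕ → Prog n
const zero    = zer
const (suc k) = app₁ sucP (const k)

const↓ : ∀ k → A ⊢ const k · xs ↓ k
const↓ zero    = zer↓
const↓ (suc k) = app₁↓ (const↓ k) suc↓

addP : Prog 2
addP = prec (proj (# 0)) (app₁ sucP (proj (# 1)))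

add↓ : ∀ x y → A ⊢ addP · (x ∷ y ∷ []) ↓ (x + y)
add↓ x y = prec↓ (_+ y) (proj↓ (# 0)) (λ _ → app₁↓ (proj↓ (# 1)) suc↓) x

triP : Prog 1
triP = prec zer (app₂ addP (app₁ sucP (proj (# 0))) (proj (# 1)))

tri↓ : ∀ x → A ⊢ triP · (x ∷ []) ↓ tri x
tri↓ = prec↓ tri zer↓ (λ y → app₂↓ (app₁↓ (proj↓ (# 0)) suc↓) (proj↓ (# 1)) (add↓ (suc y) (tri y)))

pairP : Prog 2
pairP = app₂ addP (app₁ triP addP) (proj (# 1))

pair↓ : ∀ a b → A ⊢ pairP · (a ∷ b ∷ []) ↓ pair a b
pair↓ a b = app₂↓ (app₁↓ (add↓ a b) (tri↓ (a + b))) (proj↓ (# 1)) (add↓ _ b)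

pairₚ : Prog n → Prog n → Prog n
pairₚ = app₂ pairP

pairₚ↓ : ∀ {a b u w} → A ⊢ a · xs ↓ u → A ⊢ b · xs ↓ w → A ⊢ pairₚ a b · xs ↓ pair u w
pairₚ↓ a↓ b↓ = app₂↓ a↓ b↓ (pair↓ _ _)

predP : Prog 1
predP = prec zer (proj (# 0))

pred↓ : ∀ x → A ⊢ predP · (x ∷ []) ↓ pred x
pred↓ = prec↓ pred zer↓ (λ _ → proj↓ (# 0))

-- truncated subtraction, with the subtrahend as recursion argument
monusP : Prog 2
monusP = prec (proj (# 0)) (app₁ predP (proj (# 1)))

monus↓ : ∀ k x → A ⊢ monusP · (k ∷ x ∷ []) ↓ (x ∸ k)
monus↓ k x = prec↓ (x ∸_) (proj↓ (# 0)) step k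
  where
  step : ∀ y → A ⊢ app₁ predP (proj (# 1)) · (y ∷ (x ∸ y) ∷ x ∷ []) ↓ (x ∸ suc y)
  step y rewrite sym (pred[m∸n]≡m∸[1+n] x y) = app₁↓ (proj↓ (# 1)) (pred↓ (x ∸ y))

notP : Prog 1
notP = app₂ monusP (proj (# 0)) (const 1)

not↓ : ∀ b → A ⊢ notP · (b2n b ∷ []) ↓ b2n (not b)
not↓ true  = app₂↓ (proj↓ (# 0)) (const↓ 1) (monus↓ 1 1)
not↓ false = app₂↓ (proj↓ (# 0)) (const↓ 1) (monus↓ 0 1)

at : Prog 1 → ℕ → Prog 1
at p j = app₁ p (const j)

atCode : ℕ → ℕ → ℕ
atCode i j = pair 4 (pair 1 (pair i (pair (enc (const {1} j)) 0)))

atCode-enc : ∀ (p : Prog 1) j → atCode (enc p) j ≡ enc (at p j)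
atCode-enc p j = refl

constCodeP : Prog 1
constCodeP = prec zer (pairₚ (const 4) (pairₚ (const 1)
               (pairₚ (const (enc sucP)) (pairₚ (proj (# 1)) (const 0)))))

constCode↓ : ∀ j → A ⊢ constCodeP · (j ∷ []) ↓ enc (const {1} j)
constCode↓ = prec↓ (λ j → enc (const {1} j)) zer↓
  (λ _ → pairₚ↓ (const↓ 4) (pairₚ↓ (const↓ 1) (pairₚ↓ (const↓ _) (pairₚ↓ (proj↓ (# 1)) (const↓ 0)))))

atCodeP : Prog 2
atCodeP = pairₚ (const 4) (pairₚ (const 1)
            (pairₚ (proj (# 0)) (pairₚ (app₁ constCodeP (proj (# 1))) (const 0))))

atCode↓ : ∀ i j → A ⊢ atCodeP · (i ∷ j ∷ []) ↓ atCode i j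
atCode↓ i j = pairₚ↓ (const↓ 4) (pairₚ↓ (const↓ 1)
                (pairₚ↓ (proj↓ (# 0)) (pairₚ↓ (app₁↓ (proj↓ (# 1)) (constCode↓ j)) (const↓ 0))))

φ-at : ∀ {p : Prog 1} {j v} → ∅ ⊢ p · (j ∷ []) ↓ v → φ enc (at p j) ⟨ enc (at p j) ⟩↓ v
φ-at {p} {j} {v} p↓ =
  subst (λ r → ∅ ⊢ r · (enc (at p j) ∷ []) ↓ v) (sym (decode-enc _ (at p j) ≤-refl)) (app₁↓ (const↓ j) p↓)

strCode : Str → ℕ
strCode []      = 0
strCode (b ∷ σ) = suc (pair (b2n b) (strCode σ))

cylCode : Str → ℕ
cylCode σ = suc (pair (strCode σ) 0)

decodeBit-b2n : ∀ b → decodeBit (b2n b) ≡ b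
decodeBit-b2n true  = refl
decodeBit-b2n false = refl

decodeList-strCode : ∀ f σ → strCode σ ≤ f → decodeList decodeBit f (strCode σ) ≡ σ
decodeList-strCode zero    []      _  = refl
decodeList-strCode (suc f) []      _  = refl
decodeList-strCode (suc f) (b ∷ σ) le rewrite unpair-pair (b2n b) (strCode σ) =
  cong₂ _∷_ (decodeBit-b2n b) (decodeList-strCode f σ (≤-pairʳ (b2n b) _ (s≤s⁻¹ le)))

decodeClopen-cylCode : ∀ σ → decodeClopen (cylCode σ) ≡ σ ∷ []
decodeClopen-cylCode σ rewrite unpair-pair (strCode σ) 0 =
  cong₂ _∷_ (decodeList-strCode _ σ ≤-refl) (decodeList-zero (pair (strCode σ) 0))
  where
  decodeList-zero : ∀ f → decodeList decodeStr f 0 ≡ []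
  decodeList-zero zero    = refl
  decodeList-zero (suc f) = refl

countB-++ : ∀ {S : Set} (p : S → Bool) xs ys → countB p (xs ++ ys) ≡ countB p xs + countB p ys
countB-++ p []       ys = refl
countB-++ p (x ∷ xs) ys rewrite countB-++ p xs ys = sym (+-assoc (if p x then 1 else 0) (countB p xs) (countB p ys))

countB-map : ∀ {S T : Set} (p : T → Bool) (f : S → T) xs → countB p (map f xs) ≡ countB (p ∘ f) xs
countB-map p f []       = refl
countB-map p f (x ∷ xs) = cong (_ +_) (countB-map p f xs)

countB-cong : ∀ {S : Set} {p q : S → Bool} → (∀ x → p x ≡ q x) → ∀ xs → countB p xs ≡ countB q xs
countB-cong p≗q []       = refl
countB-cong p≗q (x ∷ xs) rewrite p≗q x = cong (_ +_) (countB-cong p≗q xs)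

countB-false : ∀ {S : Set} (xs : List S) → countB (λ _ → false) xs ≡ 0
countB-false []       = refl
countB-false (x ∷ xs) = countB-false xs

extensions-of-σ : ∀ σ → countB (isPrefix σ) (strings (length σ)) ≡ 1
extensions-of-σ []      = refl
extensions-of-σ (b ∷ σ) = begin
  countB (isPrefix (b ∷ σ)) (map (false ∷_) S ++ map (true ∷_) S)
    ≡⟨ countB-++ (isPrefix (b ∷ σ)) (map (false ∷_) S) (map (true ∷_) S) ⟩
  countB (isPrefix (b ∷ σ)) (map (false ∷_) S) + countB (isPrefix (b ∷ σ)) (map (true ∷_) S)
    ≡⟨ cong₂ _+_ (countB-map _ (false ∷_) S) (countB-map _ (true ∷_) S) ⟩
  countB (isPrefix (b ∷ σ) ∘ (false ∷_)) S + countB (isPrefix (b ∷ σ) ∘ (true ∷_)) S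
    ≡⟨ halves b ⟩
  1 ∎
  where
  open ≡-Reasoning
  S = strings (length σ)
  -- only the half of the strings starting with b contributes
  halves : ∀ b → countB (isPrefix (b ∷ σ) ∘ (false ∷_)) S + countB (isPrefix (b ∷ σ) ∘ (true ∷_)) S ≡ 1
  halves false rewrite countB-false S = trans (+-identityʳ _) (extensions-of-σ σ)
  halves true  rewrite countB-false S = extensions-of-σ σ

length-segment : ∀ (X : ℕ → Bool) m → length (map X (upTo m)) ≡ m
length-segment X m = trans (length-map X (upTo m)) (length-upTo m)

cylinder-measure : ∀ σ → MeasureAtMost2^- (σ ∷ []) (length σ)
cylinder-measure σ rewrite ⊔-identityʳ (length σ)
                         | countB-cong (λ τ → ∨-identityʳ (isPrefix σ τ)) (strings (length σ))
                         | extensions-of-σ σ = ≤-reflexive (+-identityʳ _)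

segment-measure : ∀ (X : ℕ → Bool) m → MeasureAtMost2^- (map X (upTo m) ∷ []) m
segment-measure X m =
  subst (MeasureAtMost2^- (map X (upTo m) ∷ [])) (length-segment X m) (cylinder-measure (map X (upTo m)))

cylinder-member : ∀ (X : ℕ → Bool) m → X ∈C (map X (upTo m) ∷ [])
cylinder-member X m = here (cong (λ l → map X (upTo l)) (sym (length-segment X m)))

-- The initial segment Y ↾ m, built back to front: 'window Y m k' is the
-- list of the last k bits of Y ↾ m.  This is the form in which primitive
-- recursion (which can only prepend) produces Y ↾ m.

window : (ℕ → Bool) → ℕ → ℕ → Str
window Y m zero    = []
window Y m (suc k) = Y (m ∸ suc k) ∷ window Y m k

window-offset : ∀ Y n k → window Y (n + k) k ≡ map (λ j → Y (j + n)) (upTo k)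
window-offset Y n zero    = refl
window-offset Y n (suc k) = begin
  Y (n + suc k ∸ suc k) ∷ window Y (n + suc k) k
    ≡⟨ cong₂ (λ a l → Y a ∷ l) (m+n∸n≡m n (suc k)) shifted ⟩
  Y n ∷ map (λ j → Y (j + suc n)) (upTo k)
    ≡⟨ cong (Y n ∷_) (map-cong (λ j → cong Y (+-suc j n)) (upTo k)) ⟩
  Y n ∷ map (λ j → Y (suc j + n)) (upTo k)
    ≡⟨ cong (Y n ∷_) (trans (map-upTo _ k) (sym (map-applyUpTo suc (λ j → Y (j + n)) k))) ⟩
  map (λ j → Y (j + n)) (upTo (suc k))
    ∎
  where
  open ≡-Reasoning
  shifted : window Y (n + suc k) k ≡ map (λ j → Y (j + suc n)) (upTo k)
  shifted rewrite +-suc n k = window-offset Y (suc n) k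

window-full : ∀ Y m → window Y m m ≡ map Y (upTo m)
window-full Y m = trans (window-offset Y 0 m) (map-cong (λ j → cong Y (+-identityʳ j)) (upTo m))

decodeClopen-segment : ∀ Y m → decodeClopen (cylCode (window Y m m)) ≡ map Y (upTo m) ∷ []
decodeClopen-segment Y m = trans (decodeClopen-cylCode (window Y m m)) (cong (λ σ → σ ∷ []) (window-full Y m))

module Cylinders {A : Oracle} (Y : ℕ → ℕ → Bool) (bitP : Prog 2)
                 (bit↓ : ∀ i j → A ⊢ bitP · (i ∷ j ∷ []) ↓ b2n (Y i j)) where

  -- arguments (k , i , m) ↦ strCode (window (Y i) m k)
  windowP : Prog 3
  windowP = prec zer (app₁ sucP (pairₚ (app₂ bitP (proj (# 2)) (app₂ monusP (app₁ sucP (proj (# 0))) (proj (# 3))))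
                                      (proj (# 1))))

  window↓ : ∀ k i m → A ⊢ windowP · (k ∷ i ∷ m ∷ []) ↓ strCode (window (Y i) m k)
  window↓ k i m = prec↓ (λ k → strCode (window (Y i) m k)) zer↓ step k
    where
    step : ∀ y → A ⊢ _ · (y ∷ strCode (window (Y i) m y) ∷ i ∷ m ∷ []) ↓ strCode (window (Y i) m (suc y))
    step y = app₁↓ (pairₚ↓ (app₂↓ (proj↓ (# 2)) (app₂↓ (app₁↓ (proj↓ (# 0)) suc↓) (proj↓ (# 3)) (monus↓ (suc y) m))
                                 (bit↓ i (m ∸ suc y)))
                           (proj↓ (# 1)))
                   suc↓

  cylinderP : Prog 2
  cylinderP = app₁ sucP (pairₚ (comp windowP (proj (# 1) ∷ proj (# 0) ∷ proj (# 1) ∷ [])) (const 0))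

  cylinder↓ : ∀ i m → A ⊢ cylinderP · (i ∷ m ∷ []) ↓ cylCode (window (Y i) m m)
  cylinder↓ i m = app₁↓ (pairₚ↓ (comp↓ (∷↓ (proj↓ (# 1)) (∷↓ (proj↓ (# 0)) (∷↓ (proj↓ (# 1)) []↓))) (window↓ m i m))
                                (const↓ 0))
                        suc↓

-- The diagonal guesses of a DNC function g: 'guess g i j' is the bit that
-- g predicts NOT to be the value of program i at input j.  When program i
-- computes X, g cannot err, so the guesses reproduce X.

guess : (ℕ → Bool) → ℕ → ℕ → Bool
guess g i j = not (g (atCode i j))

guessP : Prog 1 → Prog 2
guessP q = app₁ notP (app₁ q atCodeP)

guess↓ : ∀ {g q} → (∀ x → A ⊢ q · (x ∷ []) ↓ b2n (g x)) → ∀ i j → A ⊢ guessP q · (i ∷ j ∷ []) ↓ b2n (guess g i j)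
guess↓ {g = g} q↓ i j = app₁↓ (app₁↓ (atCode↓ i j) (q↓ _)) (not↓ (g (atCode i j)))

not-of-different : ∀ a b → b2n a ≢ b2n b → not a ≡ b
not-of-different true  true  ne = ⊥-elim (ne refl)
not-of-different true  false _  = refl
not-of-different false true  _  = refl
not-of-different false false ne = ⊥-elim (ne refl)

guess-correct : ∀ {g : ℕ → Bool} → (∀ e v → φ e ⟨ e ⟩↓ v → b2n (g e) ≢ v) →
  ∀ {X : ℕ → Bool} (p : Prog 1) → (∀ j → ∅ ⊢ p · (j ∷ []) ↓ b2n (X j)) → ∀ j → guess g (enc p) j ≡ X j
guess-correct {g} dnc {X} p p↓ j =
  not-of-different (g (atCode (enc p) j)) (X j)
    (subst (λ e → b2n (g e) ≢ b2n (X j)) (sym (atCode-enc p j)) (dnc (enc (at p j)) (b2n (X j)) (φ-at (p↓ j))))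

theorem6 : (A : Oracle) → IsPA A → WeaklyKurtzEngulfing A
theorem6 A (g , (q , q↓) , dnc) = h , (cylinderP , cylinder↓) , measure , engulf
  where
  open Cylinders (guess g) (guessP q) (guess↓ q↓)

  h : ℕ → ℕ → ℕ
  h i m = cylCode (window (guess g i) m m)

  measure : ∀ i m → MeasureAtMost2^- (decodeClopen (h i m)) m
  measure i m = subst (λ G → MeasureAtMost2^- G m) (sym (decodeClopen-segment (guess g i) m))
                      (segment-measure (guess g i) m)

  engulf : ∀ X → Computable X → ∃ λ i → ∀ m → X ∈C decodeClopen (h i m)
  engulf X (p , p↓) = enc p , λ m → subst (X ∈C_) (sym (guesses-are-X m)) (cylinder-member X m)
    where
    guesses-are-X : ∀ m → decodeClopen (h (enc p) m) ≡ map X (upTo m) ∷ []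
    guesses-are-X m = trans (decodeClopen-segment (guess g (enc p)) m)
                            (cong (λ σ → σ ∷ []) (map-cong (guess-correct dnc p p↓) (upTo m)))
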